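{- Let $D$ be a connected Eulerian digraph and suppose $\mathcal{A}=\{\beta_1,\dots,\beta_t\}$ with $t\ge2$ is the unique partition of $D$ into cycles. Assume $V(\beta_i)\cap V(\beta_j)\neq\emptyset$ for all $1\le i<j\le t$. Then $V(\beta_1)\cap\cdots\cap V(\beta_t)$ consists of exactly one vertex.
   Context: A digraph is a triple $D=(V(D),E(D),\psi)$ with finite sets and $\psi:E(D)\to V(D)\times V(D)$ having distinct coordinates (no loops; parallel edges allowed). Walks follow edge directions; a circuit is a closed trail up to cyclic rotation; a cycle is a circuit with no repeated vertices (length $\ge2$); $\mathcal{B}(D)$ is the set of cycles. $D$ is Eulerian if it has a closed trail traversing every edge. A partition of $D$ into cycles is a set $\mathcal{A}\subseteq\mathcal{B}(D)$ whose edge sets partition $E(D)$. -}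

module Defs where

open import Data.Nat using (ℕ; _≤_)
open import Data.Fin using (Fin)
open import Data.Product using (_×_; _,_; proj₁; proj₂; Σ; ∃; ∃-syntax)
open import Data.Sum using (_⊎_)
open import Data.List using (List; []; _∷_; length; map; drop; take; _++_)
open import Data.List.Membership.Propositional using (_∈_)
open import Data.List.Relation.Unary.Unique.Propositional using (Unique)
open import Data.List.Relation.Unary.All using (All)
open import Data.Maybe using (Maybe; just; nothing)
open import Data.Unit using (⊤)
open import Data.Empty using (⊥)
open import Relation.Binary.PropositionalEquality using (_≡_; _≢_)
open import Relation.Binary.Construct.Closure.ReflexiveTransitive using (Star)

-- A digraph with vertex set Fin n, edge set Fin m, incidence map ψ
-- (tail, head), no loops, parallel edges allowed.
record Digraph : Set where
  field
    n : ℕ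
    m : ℕ
    ψ : Fin m → Fin n × Fin n
    loopless : ∀ e → proj₁ (ψ e) ≢ proj₂ (ψ e)

module _ (D : Digraph) where
  open Digraph D

  Vertex : Set
  Vertex = Fin n

  Edge : Set
  Edge = Fin m

  tail head : Edge → Vertex
  tail e = proj₁ (ψ e)
  head e = proj₂ (ψ e)

  Consecutive : List Edge → Set
  Consecutive []           = ⊤
  Consecutive (e ∷ [])     = ⊤
  Consecutive (e ∷ f ∷ es) = head e ≡ tail f × Consecutive (f ∷ es)

  lastEdge : Edge → List Edge → Edge
  lastEdge e []       = e
  lastEdge e (f ∷ es) = lastEdge f es

  ClosedWalk : List Edge → Set
  ClosedWalk []       = ⊤
  ClosedWalk (e ∷ es) = Consecutive (e ∷ es) × head (lastEdge e es) ≡ tail e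

  ClosedTrail : List Edge → Set
  ClosedTrail es = ClosedWalk es × Unique es

  verts : List Edge → List Vertex
  verts = map tail

  IsCycle : List Edge → Set
  IsCycle es = ClosedTrail es × 2 ≤ length es × Unique (verts es)

  -- circuits are taken up to cyclic rotation
  Rotation : List Edge → List Edge → Set
  Rotation xs ys = ∃[ k ] xs ≡ drop k ys ++ take k ys

  Eulerian : Set
  Eulerian = ∃[ es ] ClosedTrail es × (∀ (e : Edge) → e ∈ es)

  Adj : Vertex → Vertex → Set
  Adj u v = ∃[ e ] (ψ e ≡ (u , v) ⊎ ψ e ≡ (v , u))

  Connected : Set
  Connected = ∀ (u v : Vertex) → Star Adj u v

  IsCyclePartition : {t : ℕ} → (Fin t → List Edge) → Set
  IsCyclePartition {t} β =
    (∀ i → IsCycle (β i)) ×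
    (∀ (e : Edge) → ∃[ i ] e ∈ β i) ×
    (∀ (e : Edge) (i j : Fin t) → e ∈ β i → e ∈ β j → i ≡ j)

  SameCycleSet : {t t' : ℕ} → (Fin t → List Edge) → (Fin t' → List Edge) → Set
  SameCycleSet β γ =
    (∀ i → ∃[ j ] Rotation (β i) (γ j)) × (∀ j → ∃[ i ] Rotation (γ j) (β i))

  UniqueCyclePartition : {t : ℕ} → (Fin t → List Edge) → Set
  UniqueCyclePartition {t} β =
    IsCyclePartition β ×
    (∀ (t' : ℕ) (γ : Fin t' → List Edge) → IsCyclePartition γ → SameCycleSet β γ)

-- Uniqueness of the cycle partition β is rigid: if the edges of some of its cycles
-- β_k (k ∈ S) can be rearranged into two closed trails W₁ and W₂ with W₁ non-empty and
-- every β_k meeting W₂, decomposing W₁ and W₂ into cycles and keeping the other β's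
-- gives a second cycle partition.  A cycle of it lying inside W₁ must then be some β_k,
-- which is impossible as β_k meets W₂.  Two cycles through distinct vertices u and v
-- are rearranged this way by exchanging their u–v arcs, so two cycles share at most one
-- vertex; three cycles meeting pairwise in three distinct vertices are rearranged by
-- rotating their arcs.  Hence the vertex shared by β₁ and β₂ lies on every β_k.
module Submission where

open import Defs
open import Data.Nat using (ℕ; zero; suc; _+_; _≤_; _<_; z≤n; s≤s; z<s)
open import Data.Nat.Induction using (<-wellFounded)
open import Data.Nat.Properties using (m<m+n; m<n+m)
open import Data.Fin using (Fin; zero; suc)
open import Data.Fin.Properties using (_≟_)
open import Data.Product using (_×_; _,_; proj₁; proj₂; ∃₂; ∃-syntax)
open import Data.Sum using (_⊎_; inj₁; inj₂)
open import Data.List using (List; []; _∷_; length; map; _++_; concat; lookup; allFin; filter; drop; take)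
open import Data.List.Properties using (length-++; concat-++; map-++; ++-identityʳ; take++drop≡id)
open import Data.List.Membership.Propositional using (_∈_)
open import Data.List.Membership.Propositional.Properties
  using (∈-map⁺; ∈-map⁻; ∈-++⁺ˡ; ∈-++⁺ʳ; ∈-∃++; ∈-concat⁺′; ∈-concat⁻′; ∈-filter⁺; ∈-filter⁻; ∈-allFin; ∈-lookup)
import Data.List.Membership.DecPropositional as DecMembership
open import Data.List.Relation.Binary.Subset.Propositional using (_⊆_)
open import Data.List.Relation.Binary.Disjoint.Propositional using (Disjoint)
open import Data.List.Relation.Binary.Permutation.Propositional
  using (_↭_; ↭-refl; ↭-sym; ↭-trans; ↭-reflexive; ↭⇒↭ₛ; module PermutationReasoning)
import Data.List.Relation.Binary.Permutation.Propositional.Properties as ↭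
import Data.List.Relation.Binary.Permutation.Setoid.Properties as ↭ₛ
open import Data.List.Relation.Unary.All as All using (All; []; _∷_)
import Data.List.Relation.Unary.All.Properties as All
import Data.List.Relation.Unary.AllPairs as AllPairs
import Data.List.Relation.Unary.AllPairs.Properties as AllPairs
open import Data.List.Relation.Unary.Any as Any using (here; there)
open import Data.List.Relation.Unary.Any.Properties using (lookup-index)
open import Data.List.Relation.Unary.Unique.Propositional using (Unique; []; _∷_)
import Data.List.Relation.Unary.Unique.Propositional.Properties as Unique
open import Data.Empty using (⊥; ⊥-elim)
open import Function using (_∘_)
open import Induction.WellFounded using (Acc; acc)
open import Relation.Nullary using (yes; no)
open import Relation.Binary.PropositionalEquality using (_≡_; _≢_; refl; sym; trans; cong; subst; setoid)

module _ {A : Set} where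

  Unique-resp-↭ : {xs ys : List A} → xs ↭ ys → Unique xs → Unique ys
  Unique-resp-↭ p = ↭ₛ.Unique-resp-↭ (setoid A) (↭⇒↭ₛ p)

  Unique-++⁻ : ∀ (xs : List A) {ys} → Unique (xs ++ ys) → Unique xs × Unique ys × Disjoint xs ys
  Unique-++⁻ []       ys!           = [] , ys! , λ ()
  Unique-++⁻ (x ∷ xs) (x∉ ∷ xsys!) with Unique-++⁻ xs xsys!
  ... | xs! , ys! , xs⊥ys = All.++⁻ˡ xs x∉ ∷ xs! , ys! , x∷xs⊥ys
    where
    x∷xs⊥ys : Disjoint (x ∷ xs) _
    x∷xs⊥ys (here refl , x∈ys) = All.lookup (All.++⁻ʳ xs x∉) x∈ys refl
    x∷xs⊥ys (there y∈xs , y∈ys) = xs⊥ys (y∈xs , y∈ys)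

  ++-↭⇒⊆ˡ : {xs ys zs : List A} → xs ++ ys ↭ zs → xs ⊆ zs
  ++-↭⇒⊆ˡ p = ↭.∈-resp-↭ p ∘ ∈-++⁺ˡ

  ++-↭⇒⊆ʳ : ∀ (xs : List A) {ys zs} → xs ++ ys ↭ zs → ys ⊆ zs
  ++-↭⇒⊆ʳ xs p = ↭.∈-resp-↭ p ∘ ∈-++⁺ʳ xs

  ∈-concat⇒∈-lookup : ∀ (xss : List (List A)) {x} → x ∈ concat xss → ∃[ i ] x ∈ lookup xss i
  ∈-concat⇒∈-lookup xss x∈ with ∈-concat⁻′ xss x∈
  ... | xs , x∈xs , xs∈xss = Any.index xs∈xss , subst (_ ∈_) (lookup-index xs∈xss) x∈xs

  Unique-concat⇒lookup-disjoint : ∀ (xss : List (List A)) → Unique (concat xss) →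
    ∀ i j {x} → x ∈ lookup xss i → x ∈ lookup xss j → i ≡ j
  Unique-concat⇒lookup-disjoint (xs ∷ xss) xss! zero    zero    _ _ = refl
  Unique-concat⇒lookup-disjoint (xs ∷ xss) xss! zero    (suc j) p q =
    ⊥-elim (proj₂ (proj₂ (Unique-++⁻ xs xss!)) (p , ∈-concat⁺′ q (∈-lookup {xs = xss} j)))
  Unique-concat⇒lookup-disjoint (xs ∷ xss) xss! (suc i) zero    p q =
    ⊥-elim (proj₂ (proj₂ (Unique-++⁻ xs xss!)) (q , ∈-concat⁺′ p (∈-lookup {xs = xss} i)))
  Unique-concat⇒lookup-disjoint (xs ∷ xss) xss! (suc i) (suc j) p q =
    cong suc (Unique-concat⇒lookup-disjoint xss (proj₁ (proj₂ (Unique-++⁻ xs xss!))) i j p q)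

  rotation⇒↭ : ∀ k (ys : List A) → drop k ys ++ take k ys ↭ ys
  rotation⇒↭ k ys = ↭-trans (↭.++-comm (drop k ys) (take k ys)) (↭-reflexive (take++drop≡id k ys))

module _ {t : ℕ} where
  open DecMembership (_≟_ {t}) using (_∈?_; _∉?_)

  complement : List (Fin t) → List (Fin t)
  complement S = filter (_∉? S) (allFin t)

  complement-++-unique : ∀ {S} → Unique S → Unique (complement S ++ S)
  complement-++-unique {S} S! = Unique.++⁺ (Unique.filter⁺ (_∉? S) (Unique.allFin⁺ t)) S!
    λ (k∈∁S , k∈S) → proj₂ (∈-filter⁻ (_∉? S) {xs = allFin t} k∈∁S) k∈S

  ∈-complement-++ : ∀ S k → k ∈ complement S ++ S
  ∈-complement-++ S k with k ∈? S
  ... | yes k∈S = ∈-++⁺ʳ (complement S) k∈S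
  ... | no  k∉S = ∈-++⁺ˡ (∈-filter⁺ (_∉? S) (∈-allFin k) k∉S)

module ClosedTrails (D : Digraph) where
  open Digraph D using (loopless)
  open DecMembership (_≟_ {Digraph.n D}) using (_∈?_)

  data Walk : Vertex D → List (Edge D) → Vertex D → Set where
    nil  : ∀ {u} → Walk u [] u
    cons : ∀ {u e es v} → tail D e ≡ u → Walk (head D e) es v → Walk u (e ∷ es) v

  walk-start : ∀ {u e es v} → Walk u (e ∷ es) v → tail D e ≡ u
  walk-start (cons p _) = p

  walk-edge : ∀ {u es v} → Walk u es v → u ≢ v → ∃[ e ] e ∈ es
  walk-edge nil              u≢u = ⊥-elim (u≢u refl)
  walk-edge (cons {e = e} _ _) _ = e , here refl

  _++ʷ_ : ∀ {u v w xs ys} → Walk u xs v → Walk v ys w → Walk u (xs ++ ys) w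
  nil      ++ʷ q = q
  cons p w ++ʷ q = cons p (w ++ʷ q)

  splitʷ : ∀ {u w} xs {ys} → Walk u (xs ++ ys) w → ∃[ v ] Walk u xs v × Walk v ys w
  splitʷ []       w          = _ , nil , w
  splitʷ (x ∷ xs) (cons p w) with splitʷ xs w
  ... | v , wxs , wys = v , cons p wxs , wys

  split-at-vertex : ∀ {u es w x} → Walk u es w → x ∈ verts D es →
    ∃₂ λ xs ys → es ≡ xs ++ ys × Walk u xs x × Walk x ys w
  split-at-vertex (cons refl w) (here refl) = [] , _ , refl , nil , cons refl w
  split-at-vertex (cons p w)    (there x∈)  with split-at-vertex w x∈
  ... | xs , ys , refl , wxs , wys = _ ∷ xs , ys , refl , cons p wxs , wys

  consecutive⇒walk : ∀ {u e} es → tail D e ≡ u → Consecutive D (e ∷ es) →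
    Walk u (e ∷ es) (head D (lastEdge D e es))
  consecutive⇒walk []       p _       = cons p nil
  consecutive⇒walk (f ∷ es) p (q , c) = cons p (consecutive⇒walk es (sym q) c)

  walk⇒consecutive : ∀ {u e es v} → Walk u (e ∷ es) v →
    Consecutive D (e ∷ es) × head D (lastEdge D e es) ≡ v
  walk⇒consecutive (cons _ nil)            = _ , refl
  walk⇒consecutive (cons _ w@(cons q _)) with walk⇒consecutive w
  ... | c , last = (sym q , c) , last

  closedWalk⇒walk : ∀ {e es} → ClosedWalk D (e ∷ es) → Walk (tail D e) (e ∷ es) (tail D e)
  closedWalk⇒walk {e} {es} (c , closed) = subst (Walk (tail D e) (e ∷ es)) closed (consecutive⇒walk es refl c)

  walk⇒closedWalk : ∀ {u es} → Walk u es u → ClosedWalk D es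
  walk⇒closedWalk {es = []}    _ = _
  walk⇒closedWalk {es = _ ∷ _} w with walk⇒consecutive w
  ... | c , last = c , trans last (sym (walk-start w))

  closedWalk-arcs : ∀ {c u v} → ClosedWalk D c → u ∈ verts D c → v ∈ verts D c →
    ∃₂ λ P Q → Walk u P v × Walk v Q u × P ++ Q ↭ c
  closedWalk-arcs {e ∷ es} cw u∈ v∈ with split-at-vertex (closedWalk⇒walk cw) u∈
  ... | A , B , c≡AB , wA , wB with split-at-vertex (wB ++ʷ wA) v∈BA
    where
    v∈BA = ↭.∈-resp-↭ (↭.map⁺ (tail D) (↭.++-comm A B)) (subst (λ c → _ ∈ verts D c) c≡AB v∈)
  ... | P , Q , BA≡PQ , wP , wQ =
    P , Q , wP , wQ , ↭-trans (↭-reflexive (sym BA≡PQ)) (↭-trans (↭.++-comm B A) (↭-reflexive (sym c≡AB)))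

  cycle-edge : ∀ {c} → IsCycle D c → ∃[ e ] e ∈ c
  cycle-edge {e ∷ _} _ = e , here refl

  lookup-partition : ∀ (Cs : List (List (Edge D))) → All (IsCycle D) Cs → Unique (concat Cs) →
    (∀ e → e ∈ concat Cs) → IsCyclePartition D (lookup Cs)
  lookup-partition Cs cycles Cs! covers =
    (λ i → All.lookup cycles (∈-lookup i)) ,
    (λ e → ∈-concat⇒∈-lookup Cs (covers e)) ,
    (λ e i j → Unique-concat⇒lookup-disjoint Cs Cs! i j)

  CycleDecomposition : List (Edge D) → Set
  CycleDecomposition es = ∃[ Cs ] All (IsCycle D) Cs × concat Cs ↭ es

  decomposition-++ : ∀ {xs ys} → CycleDecomposition xs → CycleDecomposition ys → CycleDecomposition (xs ++ ys)
  decomposition-++ (Cs₁ , cycles₁ , p₁) (Cs₂ , cycles₂ , p₂) =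
    Cs₁ ++ Cs₂ , All.++⁺ cycles₁ cycles₂ , ↭-trans (↭-reflexive (sym (concat-++ Cs₁ Cs₂))) (↭.++⁺ p₁ p₂)

  decomposition-resp-↭ : ∀ {xs ys} → xs ↭ ys → CycleDecomposition xs → CycleDecomposition ys
  decomposition-resp-↭ xs↭ys (Cs , cycles , p) = Cs , cycles , ↭-trans p xs↭ys

  data RepeatedVertex : List (Edge D) → Set where
    repeated : ∀ xs f ys g zs → tail D f ≡ tail D g → RepeatedVertex (xs ++ (f ∷ ys) ++ (g ∷ zs))

  simple-or-repeated : ∀ es → Unique (verts D es) ⊎ RepeatedVertex es
  simple-or-repeated []       = inj₁ []
  simple-or-repeated (f ∷ es) with tail D f ∈? verts D es
  ... | yes f∈ with ∈-map⁻ (tail D) f∈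
  ...   | g , g∈es , same with ∈-∃++ g∈es
  ...     | ys , zs , refl = inj₂ (repeated [] f ys g zs same)
  simple-or-repeated (f ∷ es) | no f∉ with simple-or-repeated es
  ... | inj₁ simple                       = inj₁ (All.¬Any⇒All¬ _ f∉ ∷ simple)
  ... | inj₂ (repeated xs f′ ys g zs same) = inj₂ (repeated (f ∷ xs) f′ ys g zs same)

  split-at-repeated-vertex : ∀ xs {f ys g zs u} → tail D f ≡ tail D g →
    Walk u (xs ++ (f ∷ ys) ++ (g ∷ zs)) u → Walk (tail D f) (f ∷ ys) (tail D f) × Walk u (xs ++ g ∷ zs) u
  split-at-repeated-vertex xs {f} {ys} {g} {zs} {u} same w with splitʷ xs w
  ... | _ , wxs , w′ with splitʷ (f ∷ ys) w′
  ... | _ , wf@(cons refl _) , wg@(cons refl _) =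
    subst (Walk (tail D f) (f ∷ ys)) (sym same) wf , wxs ++ʷ subst (λ x → Walk x (g ∷ zs) u) (sym same) wg

  simple-closedTrail-decomposition : ∀ {u es} → Walk u es u → Unique es → Unique (verts D es) →
    CycleDecomposition es
  simple-closedTrail-decomposition {es = []}        _ _ _ = [] , [] , ↭-refl
  simple-closedTrail-decomposition {es = e ∷ []}    (cons p nil) _ _ = ⊥-elim (loopless e p)
  simple-closedTrail-decomposition {es = es@(_ ∷ _ ∷ _)} w trail simple =
    es ∷ [] , ((walk⇒closedWalk w , trail) , s≤s (s≤s z≤n) , simple) ∷ [] , ↭-reflexive (++-identityʳ es)

  closedTrail-decomposition : ∀ {u es} → Walk u es u → Unique es → CycleDecomposition es
  closedTrail-decomposition w = go (<-wellFounded _) w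
    where
    positive-length : ∀ xs {g zs} → 0 < length (xs ++ g ∷ zs)
    positive-length []      = z<s
    positive-length (_ ∷ _) = z<s

    go : ∀ {u es} → Acc _<_ (length es) → Walk u es u → Unique es → CycleDecomposition es
    go {es = es} (acc smaller) w trail with simple-or-repeated es
    ... | inj₁ simple = simple-closedTrail-decomposition w trail simple
    ... | inj₂ (repeated xs f ys g zs same) with split-at-repeated-vertex xs same w
    ... | loop , rest =
      decomposition-resp-↭ (↭-sym reorder)
        (decomposition-++ (go (smaller loop<) loop loop!) (go (smaller rest<) rest rest!))
      where
      reorder : xs ++ (f ∷ ys) ++ (g ∷ zs) ↭ (f ∷ ys) ++ (xs ++ g ∷ zs)
      reorder = ↭.shifts xs (f ∷ ys)
      split-length : length (xs ++ (f ∷ ys) ++ (g ∷ zs)) ≡ length (f ∷ ys) + length (xs ++ g ∷ zs)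
      split-length = trans (↭.↭-length reorder) (length-++ (f ∷ ys))
      loop< = subst (length (f ∷ ys) <_) (sym split-length) (m<m+n _ (positive-length xs))
      rest< = subst (length (xs ++ g ∷ zs) <_) (sym split-length) (m<n+m _ z<s)
      split! = Unique-++⁻ (f ∷ ys) (Unique-resp-↭ reorder trail)
      loop! = proj₁ split!
      rest! = proj₁ (proj₂ split!)

module Partition (D : Digraph) {t : ℕ} (β : Fin t → List (Edge D)) (partition : IsCyclePartition D β) where
  open ClosedTrails D using (cycle-edge; lookup-partition)

  β-cycle : ∀ k → IsCycle D (β k)
  β-cycle = proj₁ partition

  β-covers : ∀ e → ∃[ k ] e ∈ β k
  β-covers = proj₁ (proj₂ partition)

  β-disjoint : ∀ e i j → e ∈ β i → e ∈ β j → i ≡ j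
  β-disjoint = proj₂ (proj₂ partition)

  edgesOf : List (Fin t) → List (Edge D)
  edgesOf S = concat (map β S)

  edgesOf-++ : ∀ S T → edgesOf (S ++ T) ≡ edgesOf S ++ edgesOf T
  edgesOf-++ S T = trans (cong concat (map-++ β S T)) (sym (concat-++ (map β S) (map β T)))

  ∈-edgesOf⁺ : ∀ {S k e} → k ∈ S → e ∈ β k → e ∈ edgesOf S
  ∈-edgesOf⁺ k∈S e∈βk = ∈-concat⁺′ e∈βk (∈-map⁺ β k∈S)

  ∈-edgesOf⁻ : ∀ S {e} → e ∈ edgesOf S → ∃[ k ] k ∈ S × e ∈ β k
  ∈-edgesOf⁻ S e∈ with ∈-concat⁻′ (map β S) e∈
  ... | _ , e∈βk , βk∈ with ∈-map⁻ β βk∈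
  ...   | k , k∈S , refl = k , k∈S , e∈βk

  edgesOf-unique : ∀ {S} → Unique S → Unique (edgesOf S)
  edgesOf-unique S! = Unique.concat⁺
    (All.map⁺ (All.tabulate λ {k} _ → proj₂ (proj₁ (β-cycle k))))
    (AllPairs.map⁺ {f = β} (AllPairs.map (λ i≢j {e} (e∈βi , e∈βj) → i≢j (β-disjoint e _ _ e∈βi e∈βj)) S!))

  replacement-partition : ∀ {S} Cs → Unique S → All (IsCycle D) Cs → concat Cs ↭ edgesOf S →
    IsCyclePartition D (lookup (map β (complement S) ++ Cs))
  replacement-partition {S} Cs S! cycles Cs↭S =
    lookup-partition L
      (All.++⁺ (All.map⁺ (All.tabulate λ {k} _ → β-cycle k)) cycles)
      (Unique-resp-↭ (↭-sym L↭) (edgesOf-unique (complement-++-unique S!)))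
      (λ e → ↭.∈-resp-↭ (↭-sym L↭) (∈-edgesOf⁺ (∈-complement-++ S _) (proj₂ (β-covers e))))
    where
    open PermutationReasoning
    L = map β (complement S) ++ Cs
    L↭ : concat L ↭ edgesOf (complement S ++ S)
    L↭ = begin
      concat L                          ≡⟨ concat-++ (map β (complement S)) Cs ⟨
      edgesOf (complement S) ++ concat Cs ↭⟨ ↭.++⁺ˡ (edgesOf (complement S)) Cs↭S ⟩
      edgesOf (complement S) ++ edgesOf S ≡⟨ edgesOf-++ (complement S) S ⟨
      edgesOf (complement S ++ S)       ∎

  partition-cycle-index : ∀ {S} Cs → All (IsCycle D) Cs → concat Cs ↭ edgesOf S →
    ∀ {c k} → c ∈ Cs → c ↭ β k → k ∈ S
  partition-cycle-index {S} Cs cycles Cs↭S c∈Cs c↭βk with cycle-edge (All.lookup cycles c∈Cs)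
  ... | e , e∈c with ∈-edgesOf⁻ S (↭.∈-resp-↭ Cs↭S (∈-concat⁺′ e∈c c∈Cs))
  ... | k′ , k′∈S , e∈βk′ with β-disjoint e _ k′ (↭.∈-resp-↭ c↭βk e∈c) e∈βk′
  ... | refl = k′∈S

module Rigidity (D : Digraph) {t : ℕ} (β : Fin t → List (Edge D)) (unique : UniqueCyclePartition D β) where
  open ClosedTrails D
  open Partition D β (proj₁ unique)
  open DecMembership (_≟_ {Digraph.n D}) using (_∈?_)
  open import Algebra.Solver.CommutativeMonoid (↭.++-commutativeMonoid {A = Edge D}) using (solve; _⊜_; _⊕_; id)

  ∈-partition⇒↭ : ∀ {L c} → IsCyclePartition D (lookup L) → c ∈ L → ∃[ k ] c ↭ β k
  ∈-partition⇒↭ L-partition c∈L with proj₂ (proj₂ unique _ _ L-partition) (Any.index c∈L)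
  ... | k , n , rotated = k , subst (_↭ β k) (sym (trans (lookup-index c∈L) rotated)) (rotation⇒↭ n (β k))

  cycle-of-partition : ∀ {S} Cs → Unique S → All (IsCycle D) Cs → concat Cs ↭ edgesOf S →
    ∀ {c} → c ∈ Cs → ∃[ k ] k ∈ S × c ↭ β k
  cycle-of-partition {S} Cs S! cycles Cs↭S c∈Cs =
    let k , c↭βk = ∈-partition⇒↭ (replacement-partition Cs S! cycles Cs↭S) (∈-++⁺ʳ (map β (complement S)) c∈Cs)
    in k , partition-cycle-index Cs cycles Cs↭S c∈Cs c↭βk , c↭βk

  no-closedTrail-resplit : ∀ {S W₁ W₂ x y e} → Unique S → Walk x W₁ x → Walk y W₂ y →
    W₁ ++ W₂ ↭ edgesOf S → e ∈ W₁ → (∀ {k} → k ∈ S → ∃[ e′ ] e′ ∈ β k × e′ ∈ W₂) → ⊥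
  no-closedTrail-resplit {S} {W₁} {W₂} S! w₁ w₂ W↭S e∈W₁ meets =
    let W₁! , W₂! , W₁⊥W₂ = Unique-++⁻ W₁ (Unique-resp-↭ (↭-sym W↭S) (edgesOf-unique S!))
        W₁-decomposition@(Cs₁ , _ , Cs₁↭W₁) = closedTrail-decomposition w₁ W₁!
        Cs , cycles , Cs↭W = decomposition-++ W₁-decomposition (closedTrail-decomposition w₂ W₂!)
        c , _ , c∈Cs₁ = ∈-concat⁻′ Cs₁ (↭.∈-resp-↭ (↭-sym Cs₁↭W₁) e∈W₁)
        k , k∈S , c↭βk = cycle-of-partition Cs S! cycles (↭-trans Cs↭W W↭S) (∈-++⁺ˡ c∈Cs₁)
        e′ , e′∈βk , e′∈W₂ = meets k∈S
    in W₁⊥W₂ (↭.∈-resp-↭ Cs₁↭W₁ (∈-concat⁺′ (↭.∈-resp-↭ (↭-sym c↭βk) e′∈βk) c∈Cs₁) , e′∈W₂)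

  arc-meets : ∀ {u v P xs ys} → Walk u P v → u ≢ v → P ⊆ xs → P ⊆ ys → ∃[ e ] e ∈ xs × e ∈ ys
  arc-meets w u≢v P⊆xs P⊆ys with walk-edge w u≢v
  ... | e , e∈P = e , P⊆xs e∈P , P⊆ys e∈P

  β-closedWalk : ∀ k → ClosedWalk D (β k)
  β-closedWalk k = proj₁ (proj₁ (β-cycle k))

  cycles-meet-at-most-once : ∀ {i j u v} → i ≢ j →
    u ∈ verts D (β i) → u ∈ verts D (β j) → v ∈ verts D (β i) → v ∈ verts D (β j) → u ≡ v
  cycles-meet-at-most-once {i} {j} {u} {v} i≢j u∈i u∈j v∈i v∈j with u ≟ v
  ... | yes u≡v = u≡v
  ... | no u≢v
    with closedWalk-arcs (β-closedWalk i) u∈i v∈i | closedWalk-arcs (β-closedWalk j) u∈j v∈j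
  ... | P₁ , Q₁ , p₁ , q₁ , βi↭ | P₂ , Q₂ , p₂ , q₂ , βj↭ =
    ⊥-elim (no-closedTrail-resplit ((i≢j ∷ []) ∷ [] ∷ []) (p₁ ++ʷ q₂) (q₁ ++ʷ p₂) rearranged
             (∈-++⁺ˡ (proj₂ (walk-edge p₁ u≢v))) meets)
    where
    rearranged : (P₁ ++ Q₂) ++ (Q₁ ++ P₂) ↭ edgesOf (i ∷ j ∷ [])
    rearranged = ↭-trans
      (solve 4 (λ p₁ q₁ p₂ q₂ → (p₁ ⊕ q₂) ⊕ (q₁ ⊕ p₂) ⊜ (p₁ ⊕ q₁) ⊕ ((p₂ ⊕ q₂) ⊕ id)) ↭-refl P₁ Q₁ P₂ Q₂)
      (↭.++⁺ βi↭ (↭.++⁺ʳ [] βj↭))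
    meets : ∀ {k} → k ∈ i ∷ j ∷ [] → ∃[ e ] e ∈ β k × e ∈ Q₁ ++ P₂
    meets (here refl)         = arc-meets q₁ (u≢v ∘ sym) (++-↭⇒⊆ʳ P₁ βi↭) ∈-++⁺ˡ
    meets (there (here refl)) = arc-meets p₂ u≢v (++-↭⇒⊆ˡ βj↭) (∈-++⁺ʳ Q₁)

  no-cycle-triangle : ∀ {i j k a b c} → i ≢ j → i ≢ k → j ≢ k →
    a ∈ verts D (β i) → a ∈ verts D (β j) → b ∈ verts D (β j) → b ∈ verts D (β k) →
    c ∈ verts D (β i) → c ∈ verts D (β k) → a ≢ b → b ≢ c → a ≢ c → ⊥
  no-cycle-triangle {i} {j} {k} i≢j i≢k j≢k a∈i a∈j b∈j b∈k c∈i c∈k a≢b b≢c a≢c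
    with closedWalk-arcs (β-closedWalk i) a∈i c∈i | closedWalk-arcs (β-closedWalk j) b∈j a∈j
       | closedWalk-arcs (β-closedWalk k) c∈k b∈k
  -- W₁ goes a → c → b → a along βᵢ, βₖ, βⱼ; W₂ goes c → a → b → c along the other arcs.
  ... | Pᵢ , Qᵢ , pᵢ , qᵢ , βi↭ | Pⱼ , Qⱼ , pⱼ , qⱼ , βj↭ | Pₖ , Qₖ , pₖ , qₖ , βk↭ =
    no-closedTrail-resplit ((i≢j ∷ i≢k ∷ []) ∷ (j≢k ∷ []) ∷ [] ∷ [])
      (pᵢ ++ʷ (pₖ ++ʷ pⱼ)) (qᵢ ++ʷ (qⱼ ++ʷ qₖ)) rearranged (∈-++⁺ˡ (proj₂ (walk-edge pᵢ a≢c))) meets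
    where
    rearranged : (Pᵢ ++ Pₖ ++ Pⱼ) ++ (Qᵢ ++ Qⱼ ++ Qₖ) ↭ edgesOf (i ∷ j ∷ k ∷ [])
    rearranged = ↭-trans
      (solve 6 (λ pᵢ qᵢ pⱼ qⱼ pₖ qₖ → (pᵢ ⊕ pₖ ⊕ pⱼ) ⊕ (qᵢ ⊕ qⱼ ⊕ qₖ) ⊜ (pᵢ ⊕ qᵢ) ⊕ (pⱼ ⊕ qⱼ) ⊕ (pₖ ⊕ qₖ) ⊕ id)
        ↭-refl Pᵢ Qᵢ Pⱼ Qⱼ Pₖ Qₖ)
      (↭.++⁺ βi↭ (↭.++⁺ βj↭ (↭.++⁺ʳ [] βk↭)))
    meets : ∀ {l} → l ∈ i ∷ j ∷ k ∷ [] → ∃[ e ] e ∈ β l × e ∈ Qᵢ ++ Qⱼ ++ Qₖ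
    meets (here refl)                 = arc-meets qᵢ (a≢c ∘ sym) (++-↭⇒⊆ʳ Pᵢ βi↭) ∈-++⁺ˡ
    meets (there (here refl))         = arc-meets qⱼ a≢b (++-↭⇒⊆ʳ Pⱼ βj↭) (∈-++⁺ʳ Qᵢ ∘ ∈-++⁺ˡ)
    meets (there (there (here refl))) = arc-meets qₖ b≢c (++-↭⇒⊆ʳ Pₖ βk↭) (∈-++⁺ʳ Qᵢ ∘ ∈-++⁺ʳ Qⱼ)

  common-vertex-on-third-cycle : ∀ {i j k a} → i ≢ j → i ≢ k → j ≢ k →
    a ∈ verts D (β i) → a ∈ verts D (β j) →
    ∃[ b ] b ∈ verts D (β j) × b ∈ verts D (β k) → ∃[ c ] c ∈ verts D (β i) × c ∈ verts D (β k) →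
    a ∈ verts D (β k)
  common-vertex-on-third-cycle {i} {j} {k} {a} i≢j i≢k j≢k a∈i a∈j (b , b∈j , b∈k) (c , c∈i , c∈k)
    with a ∈? verts D (β k)
  ... | yes a∈k = a∈k
  ... | no a∉k = ⊥-elim (no-cycle-triangle i≢j i≢k j≢k a∈i a∈j b∈j b∈k c∈i c∈k (a≢ b∈k) b≢c (a≢ c∈k))
    where
    a≢ : ∀ {x} → x ∈ verts D (β k) → a ≢ x
    a≢ x∈k refl = a∉k x∈k
    b≢c : b ≢ c
    b≢c refl = a≢ b∈k (sym (cycles-meet-at-most-once i≢j c∈i b∈j a∈i a∈j))

mainTheorem7 : (D : Digraph) → Connected D → Eulerian D →
    (t : ℕ) → 2 ≤ t → (β : Fin t → List (Edge D)) →
    UniqueCyclePartition D β →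
    (∀ (i j : Fin t) → i ≢ j → ∃[ v ] (v ∈ verts D (β i) × v ∈ verts D (β j))) →
    ∃[ v ] ((∀ i → v ∈ verts D (β i)) ×
            (∀ (w : Vertex D) → (∀ i → w ∈ verts D (β i)) → w ≡ v))
mainTheorem7 D _ _ (suc (suc _)) (s≤s (s≤s z≤n)) β unique meet with meet zero (suc zero) (λ ())
... | a , a∈β₀ , a∈β₁ = a , a∈β , a-only
  where
  open Rigidity D β unique

  a∈β : ∀ k → a ∈ verts D (β k)
  a∈β zero             = a∈β₀
  a∈β (suc zero)       = a∈β₁
  a∈β k@(suc (suc _)) =
    common-vertex-on-third-cycle (λ ()) (λ ()) (λ ()) a∈β₀ a∈β₁ (meet (suc zero) k (λ ())) (meet zero k (λ ()))

  a-only : ∀ w → (∀ k → w ∈ verts D (β k)) → w ≡ a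
  a-only w w∈β = cycles-meet-at-most-once (λ ()) (w∈β zero) (w∈β (suc zero)) a∈β₀ a∈β₁
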